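{- Let $k,l\geq 0$ be integers and let $\mathcal{P}\cong\mathcal{P}_{k,l}$. Then for every integer $m>0$, the $m$-cover poset $\mathcal{P}^{\langle m\rangle}$ is a left-modular lattice.
   Context: $\mathcal{P}_{k,l}$ is the bounded poset whose proper part (the poset with least element $\hat0$ and greatest element $\hat1$ removed) is the disjoint union of a $k$-element chain and an $l$-element antichain. For a finite bounded poset $\mathcal P$ with least element $\hat0$ and $m>0$, the $m$-cover poset $\mathcal P^{\langle m\rangle}$ is the subposet of the componentwise-ordered product $\mathcal P^m$ of multichains $x_1\le\cdots\le x_m$ with $\{x_1,\dots,x_m\}\setminus\{\hat0\}$ empty, a singleton, or $\{p,q\}$ with $p\lessdot q$. In a lattice, an element $x$ is left-modular if $(q\vee x)\wedge q'=q\vee(x\wedge q')$ for all $q<q'$; the lattice is left-modular if it has a maximal chain from its least to its greatest element consisting of covering relations and of left-modular elements. -}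

module Defs where

open import Level using (0ℓ)
open import Data.Nat using (ℕ; suc)
open import Data.Fin using (Fin; zero; inject₁) renaming (_≤_ to _≤F_; suc to fsuc)
open import Data.Fin.Base using (toℕ)
open import Data.Nat using () renaming (_≤_ to _≤ℕ_)
open import Data.Unit using (⊤)
open import Data.Empty using (⊥)
open import Data.Product using (Σ; ∃; ∃-syntax; _×_; _,_)
open import Data.Sum using (_⊎_)
open import Data.Vec using (Vec; lookup)
open import Relation.Nullary using (¬_)
open import Relation.Binary.PropositionalEquality using (_≡_)
open import Relation.Binary.Core using (Rel)
open import Relation.Binary.Lattice.Structures using (IsLattice)

-- The bounded poset P_{k,l}: bottom, a k-element chain, an l-element
-- antichain, top.

data PE (k l : ℕ) : Set where
  bot : PE k l
  ch  : Fin k → PE k l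
  an  : Fin l → PE k l
  top : PE k l

_≤P_ : ∀ {k l} → PE k l → PE k l → Set
bot  ≤P _    = ⊤
ch i ≤P ch j = toℕ i ≤ℕ toℕ j
an i ≤P an j = i ≡ j
_    ≤P top  = ⊤
_    ≤P _    = ⊥

_<P_ : ∀ {k l} → PE k l → PE k l → Set
p <P q = p ≤P q × ¬ (p ≡ q)

_⋖P_ : ∀ {k l} → PE k l → PE k l → Set
p ⋖P q = p <P q × (∀ r → p <P r → r <P q → ⊥)

-- {x_1,...,x_m} \ {bot} is empty, a singleton, or {p,q} with p ⋖ q
CoverCond : ∀ {k l m} → (Fin m → PE k l) → Set
CoverCond {k} {l} {m} x =
  (Σ (PE k l) λ p → ∀ i → x i ≡ bot ⊎ x i ≡ p)
  ⊎ (Σ (PE k l) λ p → Σ (PE k l) λ q →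
       p ⋖P q × (∀ i → x i ≡ bot ⊎ x i ≡ p ⊎ x i ≡ q))

record CoverElt (k l m : ℕ) : Set where
  constructor mkCover
  field
    x     : Fin m → PE k l
    multi : ∀ (i j : Fin m) → i ≤F j → x i ≤P x j
    cond  : CoverCond x
open CoverElt public

_≤C_ : ∀ {k l m} → Rel (CoverElt k l m) 0ℓ
a ≤C b = ∀ i → x a i ≤P x b i

_≈C_ : ∀ {k l m} → Rel (CoverElt k l m) 0ℓ
a ≈C b = ∀ i → x a i ≡ x b i

module _ {A : Set} (_≈_ : Rel A 0ℓ) (_≤_ : Rel A 0ℓ) where

  Strict : Rel A 0ℓ
  Strict a b = a ≤ b × ¬ (a ≈ b)

  Covers : Rel A 0ℓ
  Covers a b = Strict a b × (∀ c → Strict a c → Strict c b → ⊥)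

  IsLeast : A → Set
  IsLeast a = ∀ b → a ≤ b

  IsGreatest : A → Set
  IsGreatest a = ∀ b → b ≤ a

  IsLeftModularElt : (_∨_ _∧_ : A → A → A) → A → Set
  IsLeftModularElt _∨_ _∧_ x =
    ∀ q q' → Strict q q' → ((q ∨ x) ∧ q') ≈ (q ∨ (x ∧ q'))

  -- a lattice is left-modular if it has a maximal chain
  -- 0̂ = c_0 ⋖ c_1 ⋖ ... ⋖ c_n = 1̂ of left-modular elements
  -- (a chain of covering relations from 0̂ to 1̂ is automatically maximal)
  HasLeftModularChain : (_∨_ _∧_ : A → A → A) → Set
  HasLeftModularChain _∨_ _∧_ =
    Σ ℕ λ n → Σ (Vec A (suc n)) λ c →
      IsLeast (lookup c zero)
      × IsGreatest (lookup c (Data.Fin.fromℕ n))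
      × (∀ (i : Fin n) → Covers (lookup c (inject₁ i)) (lookup c (fsuc i)))
      × (∀ (i : Fin (suc n)) → IsLeftModularElt _∨_ _∧_ (lookup c i))

  IsLeftModularLattice : Set
  IsLeftModularLattice =
    Σ (A → A → A) λ _∨_ → Σ (A → A → A) λ _∧_ →
      IsLattice _≈_ _≤_ _∨_ _∧_ × HasLeftModularChain _∨_ _∧_

-- In P = P_{k,l} everything above a non-bottom element, and everything below a non-top
-- element, is a chain.  Hence P is a lattice, and so is P^⟨m⟩: meets are taken entrywise,
-- joins are taken entrywise and then each entry is raised to the least value that may sit
-- below the last entry.  If k ≥ 1 or l = 0 the spine bot ⋖ ch 0 ⋖ … ⋖ ch (k-1) ⋖ top
-- is a longest chain of P, and the multichains c_n whose p-th entry is the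
-- ⌊(n + p)/m⌋-th spine element form a maximal chain of P^⟨m⟩: consecutive c_n differ
-- in a single entry, and the sum of the ranks of the entries grows by exactly one.
-- Left-modularity of c_n reduces entrywise to an inequality in P, proved by cases on
-- the entry.  The remaining case k = 0 < l follows from P_{0,l} ≅ P_{1,l-1}.

module Submission where

open import Defs
open import Level using (0ℓ)
open import Data.Nat as ℕ using (ℕ; zero; suc; _+_; _*_; _<_; z≤n; s≤s; NonZero)
open import Data.Nat.Properties as ℕ using ()
open import Data.Nat.DivMod using (_/_; /-monoˡ-≤; m/n≡1+[m∸n]/n; m<n⇒m/n≡0; m<n*o⇒m/o<n; m*n/n≡m)
open import Data.Fin as Fin using (Fin; toℕ; fromℕ; fromℕ<; inject₁)
open import Data.Fin.Properties as Fin using ()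
open import Data.Vec using (Vec; lookup; tabulate; map)
open import Data.Vec.Properties using (lookup∘tabulate; lookup-map)
open import Data.Vec.Functional using (Vector)
open import Algebra.Properties.Monoid.Sum ℕ.+-0-monoid using (sum; sum-cong-≗; sum-init-last)
open import Data.Unit using (tt)
open import Data.Empty using (⊥; ⊥-elim)
open import Data.Product using (_×_; _,_; proj₁; proj₂)
open import Data.Sum using (_⊎_; inj₁; inj₂; [_,_]′)
open import Function using (_∘_)
open import Relation.Nullary using (¬_; Dec; yes; no)
open import Relation.Nullary.Decidable using (_×-dec_; ¬?)
open import Relation.Binary.Core using (Rel)
open import Relation.Binary.Structures using (IsPartialOrder)
open import Relation.Binary.Lattice.Bundles using (Lattice)
open import Relation.Binary.Lattice.Structures using (IsLattice)
import Relation.Binary.Lattice.Properties.JoinSemilattice as JoinProperties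
import Relation.Binary.Lattice.Properties.MeetSemilattice as MeetProperties
import Relation.Binary.Reasoning.Setoid as SetoidReasoning
open import Relation.Binary.PropositionalEquality
  using (_≡_; _≢_; refl; sym; trans; cong; cong₂; subst; subst₂; module ≡-Reasoning)

module _ {A : Set} (_≈_ _≤_ : Rel A 0ℓ) (rank : A → ℕ)
  (rank-cong : ∀ {a b} → a ≈ b → rank a ≡ rank b)
  (rank-strict : ∀ {a b} → Strict _≈_ _≤_ a b → rank a ℕ.< rank b) where

  covers-by-rank : ∀ {a b} → a ≤ b → rank b ≡ suc (rank a) → Covers _≈_ _≤_ a b
  covers-by-rank a≤b step =
    (a≤b , λ a≈b → ℕ.1+n≢n (sym (trans (rank-cong a≈b) step))) ,
    λ c a<c c<b → ℕ.<⇒≱ (rank-strict a<c) (ℕ.≤-pred (subst (rank c ℕ.<_) step (rank-strict c<b)))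

module _ {A : Set} {_≈_ _≤_ : Rel A 0ℓ} {_∨_ _∧_ : A → A → A}
  (L : IsLattice _≈_ _≤_ _∨_ _∧_) where

  open IsLattice L using (antisym; x≤x∨y; y≤x∨y; ∨-least; x∧y≤x; x∧y≤y; ∧-greatest)
    renaming (trans to ≤-trans)

  -- One half of the left-modular law holds in every lattice; for the other it suffices to
  -- treat a ≤ a' with c ∧ a' ≤ a, applied to a = q ∨ (c ∧ q').
  leftModular-by-retraction : (c : A) →
    (∀ a a' → a ≤ a' → (c ∧ a') ≤ a → ((a ∨ c) ∧ a') ≤ a) →
    IsLeftModularElt _≈_ _≤_ _∨_ _∧_ c
  leftModular-by-retraction c retract q q' (q≤q' , _) = antisym L≤R R≤L
    where
    R = q ∨ (c ∧ q')
    q≤R : q ≤ R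
    q≤R = x≤x∨y q (c ∧ q')
    R≤q' : R ≤ q'
    R≤q' = ∨-least q≤q' (x∧y≤y c q')
    R≤L : R ≤ ((q ∨ c) ∧ q')
    R≤L = ∨-least (∧-greatest (x≤x∨y q c) q≤q')
                  (∧-greatest (≤-trans (x∧y≤x c q') (y≤x∨y q c)) (x∧y≤y c q'))
    L≤R : ((q ∨ c) ∧ q') ≤ R
    L≤R = ≤-trans
      (∧-greatest (≤-trans (x∧y≤x (q ∨ c) q') (∨-least (≤-trans q≤R (x≤x∨y R c)) (y≤x∨y R c)))
                  (x∧y≤y (q ∨ c) q'))
      (retract R q' R≤q' (y≤x∨y q (c ∧ q')))

module OrderIsoTransport {A B : Set} {_≈A_ _≤A_ : Rel A 0ℓ} {_≈B_ _≤B_ : Rel B 0ℓ}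
  {_∨A_ _∧A_ : A → A → A} {_∨B_ _∧B_ : B → B → B}
  (LA : IsLattice _≈A_ _≤A_ _∨A_ _∧A_) (LB : IsLattice _≈B_ _≤B_ _∨B_ _∧B_)
  (Φ : A → B) (Ψ : B → A)
  (Φ-mono : ∀ {a a'} → a ≤A a' → Φ a ≤B Φ a') (Ψ-mono : ∀ {b b'} → b ≤B b' → Ψ b ≤A Ψ b')
  (ΨΦ : ∀ a → Ψ (Φ a) ≈A a) (ΦΨ : ∀ b → Φ (Ψ b) ≈B b) where

  private
    module A = IsLattice LA
    module B = IsLattice LB
    latticeA : Lattice 0ℓ 0ℓ 0ℓ
    latticeA = record { isLattice = LA }
    open JoinProperties (Lattice.joinSemilattice latticeA) using (∨-cong)
    open MeetProperties (Lattice.meetSemilattice latticeA) using (∧-cong)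

  Ψ-cong : ∀ {b b'} → b ≈B b' → Ψ b ≈A Ψ b'
  Ψ-cong b≈b' = A.antisym (Ψ-mono (B.reflexive b≈b')) (Ψ-mono (B.reflexive (B.Eq.sym b≈b')))

  Ψ≤⇒≤Φ : ∀ {b a} → Ψ b ≤A a → b ≤B Φ a
  Ψ≤⇒≤Φ {b} Ψb≤a = B.trans (B.reflexive (B.Eq.sym (ΦΨ b))) (Φ-mono Ψb≤a)

  ≤Ψ⇒Φ≤ : ∀ {a b} → a ≤A Ψ b → Φ a ≤B b
  ≤Ψ⇒Φ≤ {b = b} a≤Ψb = B.trans (Φ-mono a≤Ψb) (B.reflexive (ΦΨ b))

  ≤Φ⇒Ψ≤ : ∀ {b a} → b ≤B Φ a → Ψ b ≤A a
  ≤Φ⇒Ψ≤ {a = a} b≤Φa = A.trans (Ψ-mono b≤Φa) (A.reflexive (ΨΦ a))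

  Φ≤⇒≤Ψ : ∀ {a b} → Φ a ≤B b → a ≤A Ψ b
  Φ≤⇒≤Ψ {a} Φa≤b = A.trans (A.reflexive (A.Eq.sym (ΨΦ a))) (Ψ-mono Φa≤b)

  Ψ-reflects-≤ : ∀ {b b'} → Ψ b ≤A Ψ b' → b ≤B b'
  Ψ-reflects-≤ {b' = b'} Ψb≤Ψb' = B.trans (Ψ≤⇒≤Φ Ψb≤Ψb') (B.reflexive (ΦΨ b'))

  Ψ-reflects-≈ : ∀ {b b'} → Ψ b ≈A Ψ b' → b ≈B b'
  Ψ-reflects-≈ Ψb≈Ψb' =
    B.antisym (Ψ-reflects-≤ (A.reflexive Ψb≈Ψb')) (Ψ-reflects-≤ (A.reflexive (A.Eq.sym Ψb≈Ψb')))

  Ψ-∨ : ∀ b b' → Ψ (b ∨B b') ≈A (Ψ b ∨A Ψ b')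
  Ψ-∨ b b' = A.antisym
    (≤Φ⇒Ψ≤ (B.∨-least (Ψ≤⇒≤Φ (A.x≤x∨y (Ψ b) (Ψ b'))) (Ψ≤⇒≤Φ (A.y≤x∨y (Ψ b) (Ψ b')))))
    (A.∨-least (Ψ-mono (B.x≤x∨y b b')) (Ψ-mono (B.y≤x∨y b b')))

  Ψ-∧ : ∀ b b' → Ψ (b ∧B b') ≈A (Ψ b ∧A Ψ b')
  Ψ-∧ b b' = A.antisym
    (A.∧-greatest (Ψ-mono (B.x∧y≤x b b')) (Ψ-mono (B.x∧y≤y b b')))
    (Φ≤⇒≤Ψ (B.∧-greatest (≤Ψ⇒Φ≤ (A.x∧y≤x (Ψ b) (Ψ b'))) (≤Ψ⇒Φ≤ (A.x∧y≤y (Ψ b) (Ψ b')))))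

  Ψ-covers : ∀ {b b'} → Covers _≈B_ _≤B_ b b' → Covers _≈A_ _≤A_ (Ψ b) (Ψ b')
  Ψ-covers {b} {b'} ((b≤b' , b≉b') , between) =
    (Ψ-mono b≤b' , b≉b' ∘ Ψ-reflects-≈) ,
    λ c (Ψb≤c , Ψb≉c) (c≤Ψb' , c≉Ψb') → between (Φ c)
      (Ψ≤⇒≤Φ Ψb≤c , λ b≈Φc → Ψb≉c (A.Eq.trans (Ψ-cong b≈Φc) (ΨΦ c)))
      (≤Ψ⇒Φ≤ c≤Ψb' , λ Φc≈b' → c≉Ψb' (A.Eq.trans (A.Eq.sym (ΨΦ c)) (Ψ-cong Φc≈b')))

  Ψ-leftModular : ∀ y → IsLeftModularElt _≈B_ _≤B_ _∨B_ _∧B_ y →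
    IsLeftModularElt _≈A_ _≤A_ _∨A_ _∧A_ (Ψ y)
  Ψ-leftModular y y-lm q q' (q≤q' , q≉q') = begin
    (q ∨A Ψ y) ∧A q'
      ≈⟨ ∧-cong (∨-cong (ΨΦ q) A.Eq.refl) (ΨΦ q') ⟨
    (Ψ (Φ q) ∨A Ψ y) ∧A Ψ (Φ q')
      ≈⟨ A.Eq.trans (Ψ-∧ (Φ q ∨B y) (Φ q')) (∧-cong (Ψ-∨ (Φ q) y) A.Eq.refl) ⟨
    Ψ ((Φ q ∨B y) ∧B Φ q')
      ≈⟨ Ψ-cong (y-lm (Φ q) (Φ q') (Φ-mono q≤q' , Φq≉Φq')) ⟩
    Ψ (Φ q ∨B (y ∧B Φ q'))
      ≈⟨ A.Eq.trans (Ψ-∨ (Φ q) (y ∧B Φ q')) (∨-cong A.Eq.refl (Ψ-∧ y (Φ q'))) ⟩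
    Ψ (Φ q) ∨A (Ψ y ∧A Ψ (Φ q'))
      ≈⟨ ∨-cong (ΨΦ q) (∧-cong A.Eq.refl (ΨΦ q')) ⟩
    q ∨A (Ψ y ∧A q')
      ∎
    where
    open SetoidReasoning (Lattice.setoid latticeA)
    Φq≉Φq' : ¬ (Φ q ≈B Φ q')
    Φq≉Φq' Φq≈Φq' = q≉q' (A.Eq.trans (A.Eq.sym (ΨΦ q)) (A.Eq.trans (Ψ-cong Φq≈Φq') (ΨΦ q')))

  Ψ-chain : HasLeftModularChain _≈B_ _≤B_ _∨B_ _∧B_ → HasLeftModularChain _≈A_ _≤A_ _∨A_ _∧A_
  Ψ-chain (n , c , least , greatest , covers , leftModular) =
    n , map Ψ c ,
    subst (IsLeast _≈A_ _≤A_) (sym (lookup-map Fin.zero Ψ c)) (≤Φ⇒Ψ≤ ∘ least ∘ Φ) ,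
    subst (IsGreatest _≈A_ _≤A_) (sym (lookup-map (fromℕ n) Ψ c)) (Φ≤⇒≤Ψ ∘ greatest ∘ Φ) ,
    (λ i → subst₂ (Covers _≈A_ _≤A_)
             (sym (lookup-map (inject₁ i) Ψ c)) (sym (lookup-map (Fin.suc i) Ψ c)) (Ψ-covers (covers i))) ,
    (λ i → subst (IsLeftModularElt _≈A_ _≤A_ _∨A_ _∧A_) (sym (lookup-map i Ψ c))
             (Ψ-leftModular _ (leftModular i)))

sum-mono-≤ : ∀ {n} (f g : Vector ℕ n) → (∀ p → f p ℕ.≤ g p) → sum f ℕ.≤ sum g
sum-mono-≤ {zero}  f g f≤g = z≤n
sum-mono-≤ {suc n} f g f≤g =
  ℕ.+-mono-≤ (f≤g Fin.zero) (sum-mono-≤ (f ∘ Fin.suc) (g ∘ Fin.suc) (f≤g ∘ Fin.suc))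

sum-mono-< : ∀ {n} (f g : Vector ℕ n) → (∀ p → f p ℕ.≤ g p) →
  (p₀ : Fin n) → f p₀ ℕ.< g p₀ → sum f ℕ.< sum g
sum-mono-< f g f≤g Fin.zero f<g =
  ℕ.+-mono-<-≤ f<g (sum-mono-≤ (f ∘ Fin.suc) (g ∘ Fin.suc) (f≤g ∘ Fin.suc))
sum-mono-< f g f≤g (Fin.suc p₀) f<g =
  ℕ.+-mono-≤-< (f≤g Fin.zero) (sum-mono-< (f ∘ Fin.suc) (g ∘ Fin.suc) (f≤g ∘ Fin.suc) p₀ f<g)

sum-window-shift : (h : ℕ → ℕ) (a n : ℕ) →
  h a + sum (λ (p : Fin n) → h (suc a + toℕ p)) ≡ sum (λ (p : Fin n) → h (a + toℕ p)) + h (a + n)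
sum-window-shift h a n = begin
  h a + sum (λ (p : Fin n) → h (suc a + toℕ p))
    ≡⟨ cong₂ _+_ (cong h (sym (ℕ.+-identityʳ a)))
                 (sum-cong-≗ λ (p : Fin n) → cong h (sym (ℕ.+-suc a (toℕ p)))) ⟩
  sum window
    ≡⟨ sum-init-last window ⟩
  sum (window ∘ inject₁) + window (fromℕ n)
    ≡⟨ cong₂ _+_ (sum-cong-≗ λ (p : Fin n) → cong (λ i → h (a + i)) (Fin.toℕ-inject₁ p))
                 (cong (λ i → h (a + i)) (Fin.toℕ-fromℕ n)) ⟩
  sum (λ (p : Fin n) → h (a + toℕ p)) + h (a + n)
    ∎
  where
  open ≡-Reasoning
  window : Vector ℕ (suc n)
  window p = h (a + toℕ p)

+-/-step : (a n : ℕ) .{{_ : NonZero n}} → (a + n) / n ≡ suc (a / n)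
+-/-step a n = trans (m/n≡1+[m∸n]/n (ℕ.m≤n+m n a)) (cong (λ b → suc (b / n)) (ℕ.m+n∸n≡m a n))

-- The lattice P_{k,l}

module _ {k l : ℕ} where

  ≤P-refl : (p : PE k l) → p ≤P p
  ≤P-refl bot    = tt
  ≤P-refl (ch i) = ℕ.≤-refl
  ≤P-refl (an i) = refl
  ≤P-refl top    = tt

  ≤P-reflexive : {p q : PE k l} → p ≡ q → p ≤P q
  ≤P-reflexive {p} refl = ≤P-refl p

  ≤P-top : (p : PE k l) → p ≤P top
  ≤P-top bot    = tt
  ≤P-top (ch _) = tt
  ≤P-top (an _) = tt
  ≤P-top top    = tt

  ≤P-bot : (p : PE k l) → p ≤P bot → p ≡ bot
  ≤P-bot bot _ = refl

  top-≤P : (p : PE k l) → top ≤P p → p ≡ top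
  top-≤P top _ = refl

  ≤P-trans : (p q r : PE k l) → p ≤P q → q ≤P r → p ≤P r
  ≤P-trans p      q      top    _ _ = ≤P-top p
  ≤P-trans bot    q      r      _ _ = tt
  ≤P-trans (ch i) (ch j) (ch h) a b = ℕ.≤-trans a b
  ≤P-trans (an i) (an j) (an h) a b = trans a b
  ≤P-trans (ch _) (ch _) bot    _ ()
  ≤P-trans (ch _) (ch _) (an _) _ ()
  ≤P-trans (an _) (an _) bot    _ ()
  ≤P-trans (an _) (an _) (ch _) _ ()
  ≤P-trans (ch _) top    bot    _ ()
  ≤P-trans (ch _) top    (ch _) _ ()
  ≤P-trans (ch _) top    (an _) _ ()
  ≤P-trans top    top    bot    _ ()
  ≤P-trans top    top    (ch _) _ ()
  ≤P-trans top    top    (an _) _ ()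

  ≤P-antisym : (p q : PE k l) → p ≤P q → q ≤P p → p ≡ q
  ≤P-antisym bot    bot    _ _ = refl
  ≤P-antisym (ch i) (ch j) a b = cong ch (Fin.toℕ-injective (ℕ.≤-antisym a b))
  ≤P-antisym (an i) (an j) a _ = cong an a
  ≤P-antisym top    top    _ _ = refl

  _≤P?_ : (p q : PE k l) → Dec (p ≤P q)
  bot  ≤P? _    = yes tt
  ch i ≤P? ch j = toℕ i ℕ.≤? toℕ j
  an i ≤P? an j = i Fin.≟ j
  ch _ ≤P? top  = yes tt
  an _ ≤P? top  = yes tt
  top  ≤P? top  = yes tt
  ch _ ≤P? bot  = no λ ()
  ch _ ≤P? an _ = no λ ()
  an _ ≤P? bot  = no λ ()
  an _ ≤P? ch _ = no λ ()
  top  ≤P? bot  = no λ ()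
  top  ≤P? ch _ = no λ ()
  top  ≤P? an _ = no λ ()

  _≟P_ : (p q : PE k l) → Dec (p ≡ q)
  p ≟P q with p ≤P? q | q ≤P? p
  ... | yes a | yes b = yes (≤P-antisym p q a b)
  ... | no  a | _     = no λ e → a (≤P-reflexive e)
  ... | yes _ | no b  = no λ e → b (≤P-reflexive (sym e))

  upset-total : (z p q : PE k l) → z ≢ bot → z ≤P p → z ≤P q → p ≤P q ⊎ q ≤P p
  upset-total bot    _      _      z≢⊥ _ _ = ⊥-elim (z≢⊥ refl)
  upset-total (ch i) (ch j) (ch h) _   _ _ = ℕ.≤-total (toℕ j) (toℕ h)
  upset-total (an i) (an j) (an h) _   refl refl = inj₁ refl
  upset-total z      p      top    _   _ _ = inj₁ (≤P-top p)
  upset-total z      top    q      _   _ _ = inj₂ (≤P-top q)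

  downset-total : (z p q : PE k l) → z ≢ top → p ≤P z → q ≤P z → p ≤P q ⊎ q ≤P p
  downset-total top    _      _      z≢⊤ _ _ = ⊥-elim (z≢⊤ refl)
  downset-total z      bot    q      _   _ _ = inj₁ tt
  downset-total z      p      bot    _   _ _ = inj₂ tt
  downset-total (ch i) (ch j) (ch h) _   _ _ = ℕ.≤-total (toℕ j) (toℕ h)
  downset-total (an i) (an j) (an h) _   refl refl = inj₁ refl

  _∧P_ : PE k l → PE k l → PE k l
  p ∧P q with p ≤P? q | q ≤P? p
  ... | yes _ | _     = p
  ... | no _  | yes _ = q
  ... | no _  | no _  = bot

  _∨P_ : PE k l → PE k l → PE k l
  p ∨P q with p ≤P? q | q ≤P? p
  ... | yes _ | _     = q
  ... | no _  | yes _ = p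
  ... | no _  | no _  = top

  ∧P-lowerˡ : (p q : PE k l) → (p ∧P q) ≤P p
  ∧P-lowerˡ p q with p ≤P? q | q ≤P? p
  ... | yes _ | _     = ≤P-refl p
  ... | no _  | yes b = b
  ... | no _  | no _  = tt

  ∧P-lowerʳ : (p q : PE k l) → (p ∧P q) ≤P q
  ∧P-lowerʳ p q with p ≤P? q | q ≤P? p
  ... | yes a | _     = a
  ... | no _  | yes _ = ≤P-refl q
  ... | no _  | no _  = tt

  ∧P-greatest : (z p q : PE k l) → z ≤P p → z ≤P q → z ≤P (p ∧P q)
  ∧P-greatest z p q a b with p ≤P? q | q ≤P? p
  ... | yes _ | _     = a
  ... | no _  | yes _ = b
  ... | no p≰q | no q≰p with z ≟P bot
  ...   | yes refl = tt
  ...   | no z≢⊥ with upset-total z p q z≢⊥ a b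
  ...     | inj₁ p≤q = ⊥-elim (p≰q p≤q)
  ...     | inj₂ q≤p = ⊥-elim (q≰p q≤p)

  ∨P-upperˡ : (p q : PE k l) → p ≤P (p ∨P q)
  ∨P-upperˡ p q with p ≤P? q | q ≤P? p
  ... | yes a | _     = a
  ... | no _  | yes _ = ≤P-refl p
  ... | no _  | no _  = ≤P-top p

  ∨P-upperʳ : (p q : PE k l) → q ≤P (p ∨P q)
  ∨P-upperʳ p q with p ≤P? q | q ≤P? p
  ... | yes _ | _     = ≤P-refl q
  ... | no _  | yes b = b
  ... | no _  | no _  = ≤P-top q

  ∨P-least : (z p q : PE k l) → p ≤P z → q ≤P z → (p ∨P q) ≤P z
  ∨P-least z p q a b with p ≤P? q | q ≤P? p
  ... | yes _ | _     = b
  ... | no _  | yes _ = a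
  ... | no p≰q | no q≰p with z ≟P top
  ...   | yes refl = tt
  ...   | no z≢⊤ with downset-total z p q z≢⊤ a b
  ...     | inj₁ p≤q = ⊥-elim (p≰q p≤q)
  ...     | inj₂ q≤p = ⊥-elim (q≰p q≤p)

  ∧P-trichotomy : (p q : PE k l) →
    (p ≤P q × p ∧P q ≡ p) ⊎ (q ≤P p × p ∧P q ≡ q) ⊎ p ∧P q ≡ bot
  ∧P-trichotomy p q with p ≤P? q | q ≤P? p
  ... | yes a | _     = inj₁ (a , refl)
  ... | no _  | yes b = inj₂ (inj₁ (b , refl))
  ... | no _  | no _  = inj₂ (inj₂ refl)

  ∨P-≥-≡ : (p q : PE k l) → q ≤P p → p ∨P q ≡ p
  ∨P-≥-≡ p q q≤p = ≤P-antisym _ p (∨P-least p p q (≤P-refl p) q≤p) (∨P-upperˡ p q)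

  ∧P-≤-≡ : (p q : PE k l) → p ≤P q → p ∧P q ≡ p
  ∧P-≤-≡ p q p≤q = ≤P-antisym _ p (∧P-lowerˡ p q) (∧P-greatest p p q (≤P-refl p) p≤q)

  ∧P-comm : (p q : PE k l) → p ∧P q ≡ q ∧P p
  ∧P-comm p q = ≤P-antisym _ _
    (∧P-greatest _ q p (∧P-lowerʳ p q) (∧P-lowerˡ p q))
    (∧P-greatest _ p q (∧P-lowerʳ q p) (∧P-lowerˡ q p))

  ∧P-≥-≡ : (p q : PE k l) → q ≤P p → p ∧P q ≡ q
  ∧P-≥-≡ p q q≤p = trans (∧P-comm p q) (∧P-≤-≡ q p q≤p)

-- The spine is at least as long as the chains bot ⋖ an s ⋖ top, so rank is strictly monotone.
LongSpine : ℕ → ℕ → Set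
LongSpine k l = 1 ℕ.≤ k ⊎ l ≡ 0

module _ {k l : ℕ} where

  <P-≤P-trans : (a b c : PE k l) → a <P b → b ≤P c → a <P c
  <P-≤P-trans a b c (a≤b , a≢b) b≤c =
    ≤P-trans a b c a≤b b≤c ,
    λ a≡c → a≢b (≤P-antisym a b a≤b (subst (b ≤P_) (sym a≡c) b≤c))

  ≤P-<P-trans : (a b c : PE k l) → a ≤P b → b <P c → a <P c
  ≤P-<P-trans a b c a≤b (b≤c , b≢c) =
    ≤P-trans a b c a≤b b≤c ,
    λ a≡c → b≢c (≤P-antisym b c b≤c (subst (_≤P b) a≡c a≤b))

  ⋖P-≤ : {p q : PE k l} → p ⋖P q → p ≤P q
  ⋖P-≤ = proj₁ ∘ proj₁

  ⋖P-maximal : (a b c : PE k l) → a ⋖P b → a ≤P c → c <P b → c ≡ a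
  ⋖P-maximal a b c a⋖b a≤c c<b with c ≟P a
  ... | yes c≡a = c≡a
  ... | no c≢a  = ⊥-elim (proj₂ a⋖b c (a≤c , c≢a ∘ sym) c<b)

  ⋖P-upper-unique : (a b b' : PE k l) → a ⋖P b → a ⋖P b' → b ≤P b' → b ≡ b'
  ⋖P-upper-unique a b b' a⋖b a⋖b' b≤b' with b ≟P b'
  ... | yes b≡b' = b≡b'
  ... | no b≢b'  = ⊥-elim (proj₂ a⋖b' b (proj₁ a⋖b) (b≤b' , b≢b'))

  an⋖top : (s : Fin l) → _⋖P_ {k} (an s) top
  an⋖top s = (tt , λ ()) , between
    where
    between : ∀ r → an s <P r → r <P top → ⊥
    between (an _) (refl , s≢r) _ = s≢r refl
    between top    _ (_ , r≢⊤)    = r≢⊤ refl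

  spine : ℕ → PE k l
  spine zero = bot
  spine (suc i) with i ℕ.<? k
  ... | yes i<k = ch (fromℕ< i<k)
  ... | no _    = top

  spine-ch : (i : Fin k) → spine (suc (toℕ i)) ≡ ch i
  spine-ch i with toℕ i ℕ.<? k
  ... | yes i<k = cong ch (Fin.fromℕ<-toℕ i i<k)
  ... | no  i≮k = ⊥-elim (i≮k (Fin.toℕ<n i))

  spine-top : (j : ℕ) → k ℕ.< j → spine j ≡ top
  spine-top (suc i) (s≤s k≤i) with i ℕ.<? k
  ... | yes i<k = ⊥-elim (ℕ.≤⇒≯ k≤i i<k)
  ... | no _    = refl

  spine-mono : (j j' : ℕ) → j ℕ.≤ j' → spine j ≤P spine j'
  spine-mono zero    _        _         = tt
  spine-mono (suc i) (suc i') (s≤s i≤i') with i ℕ.<? k | i' ℕ.<? k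
  ... | yes i<k | yes i'<k = subst₂ ℕ._≤_ (sym (Fin.toℕ-fromℕ< i<k)) (sym (Fin.toℕ-fromℕ< i'<k)) i≤i'
  ... | yes _   | no _     = tt
  ... | no i≮k  | yes i'<k = ⊥-elim (i≮k (ℕ.≤-<-trans i≤i' i'<k))
  ... | no _    | no _     = tt

  spine-reflect : (j j' : ℕ) → spine j ≤P spine j' → j' ℕ.≤ k → j ℕ.≤ j'
  spine-reflect zero    _        _   _     = z≤n
  spine-reflect (suc i) zero     le  _     with i ℕ.<? k
  spine-reflect (suc i) zero     ()  _     | yes _
  spine-reflect (suc i) zero     ()  _     | no _
  spine-reflect (suc i) (suc i') le  i'<k  with i ℕ.<? k | i' ℕ.<? k
  ... | yes i<k | yes i'<k = s≤s (subst₂ ℕ._≤_ (Fin.toℕ-fromℕ< i<k) (Fin.toℕ-fromℕ< i'<k) le)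
  ... | _       | no i'≮k  = ⊥-elim (i'≮k i'<k)
  spine-reflect (suc i) (suc i') () _ | no _ | yes _

  rank : PE k l → ℕ
  rank bot    = 0
  rank (ch i) = suc (toℕ i)
  rank (an _) = 1
  rank top    = suc k

  rank-spine : (j : ℕ) → j ℕ.≤ suc k → rank (spine j) ≡ j
  rank-spine zero    _         = refl
  rank-spine (suc i) (s≤s i≤k) with i ℕ.<? k
  ... | yes i<k = cong suc (Fin.toℕ-fromℕ< i<k)
  ... | no  i≮k = cong suc (ℕ.≤-antisym (ℕ.≮⇒≥ i≮k) i≤k)

  rank-mono : (p q : PE k l) → p ≤P q → rank p ℕ.≤ rank q
  rank-mono bot    q      _   = z≤n
  rank-mono (ch i) (ch j) i≤j = s≤s i≤j
  rank-mono (ch i) top    _   = ℕ.m≤n⇒m≤1+n (Fin.toℕ<n i)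
  rank-mono (an i) (an j) _   = ℕ.≤-refl
  rank-mono (an i) top    _   = s≤s z≤n
  rank-mono top    top    _   = ℕ.≤-refl

  rank-strict : LongSpine k l → {p q : PE k l} → p <P q → rank p ℕ.< rank q
  rank-strict _ {bot}  {bot}  (_ , p≢q)   = ⊥-elim (p≢q refl)
  rank-strict _ {bot}  {ch _} _           = s≤s z≤n
  rank-strict _ {bot}  {an _} _           = s≤s z≤n
  rank-strict _ {bot}  {top}  _           = s≤s z≤n
  rank-strict _ {ch i} {ch j} (i≤j , p≢q) = s≤s (ℕ.≤∧≢⇒< i≤j (p≢q ∘ cong ch ∘ Fin.toℕ-injective))
  rank-strict _ {ch i} {top}  _           = s≤s (Fin.toℕ<n i)
  rank-strict _ {an _} {an _} (refl , p≢q) = ⊥-elim (p≢q refl)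
  rank-strict (inj₁ 1≤k) {an _} {top} _   = s≤s 1≤k
  rank-strict (inj₂ refl) {an ()} {top} _
  rank-strict _ {top}  {top}  (_ , p≢q)   = ⊥-elim (p≢q refl)

  spine-⋖ : LongSpine k l → (j : ℕ) → j ℕ.≤ k → spine j ⋖P spine (suc j)
  spine-⋖ long j j≤k =
    covers-by-rank _≡_ _≤P_ rank (cong rank) (rank-strict long)
      (spine-mono j (suc j) (ℕ.n≤1+n j))
      (trans (rank-spine (suc j) (s≤s j≤k)) (cong suc (sym (rank-spine j (ℕ.m≤n⇒m≤1+n j≤k)))))

  ch⇒LongSpine : Fin k → LongSpine k l
  ch⇒LongSpine i = inj₁ (ℕ.≤-trans (s≤s z≤n) (Fin.toℕ<n i))

  -- For bot ≢ z <P t, the coatom of the interval [bot, t] lying above z (junk otherwise).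
  coatomOver : PE k l → PE k l → PE k l
  coatomOver _      (ch j) = spine (toℕ j)
  coatomOver (ch _) top    = spine k
  coatomOver (an s) top    = an s
  coatomOver _      _      = bot

  coatomOver-≥ : (z t : PE k l) → z ≢ bot → z <P t → z ≤P coatomOver z t
  coatomOver-≥ bot    _      z≢⊥ _           = ⊥-elim (z≢⊥ refl)
  coatomOver-≥ (ch i) (ch j) _   (i≤j , z≢t) =
    subst (_≤P spine (toℕ j)) (spine-ch i)
      (spine-mono _ _ (ℕ.≤∧≢⇒< i≤j (z≢t ∘ cong ch ∘ Fin.toℕ-injective)))
  coatomOver-≥ (ch i) top    _   _           = subst (_≤P spine k) (spine-ch i) (spine-mono _ _ (Fin.toℕ<n i))
  coatomOver-≥ (an s) top    _   _           = refl
  coatomOver-≥ (an s) (an _) _   (refl , z≢t) = ⊥-elim (z≢t refl)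
  coatomOver-≥ top    top    _   (_ , z≢t)   = ⊥-elim (z≢t refl)

  coatomOver-⋖ : (z t : PE k l) → z ≢ bot → z <P t → coatomOver z t ⋖P t
  coatomOver-⋖ bot    _      z≢⊥ _ = ⊥-elim (z≢⊥ refl)
  coatomOver-⋖ (ch i) (ch j) _   _ =
    subst (spine (toℕ j) ⋖P_) (spine-ch j) (spine-⋖ (ch⇒LongSpine i) (toℕ j) (ℕ.<⇒≤ (Fin.toℕ<n j)))
  coatomOver-⋖ (ch i) top    _   _ =
    subst (spine k ⋖P_) (spine-top (suc k) ℕ.≤-refl) (spine-⋖ (ch⇒LongSpine i) k ℕ.≤-refl)
  coatomOver-⋖ (an s) top    _   _ = an⋖top s
  coatomOver-⋖ (an s) (an _) _   (refl , z≢t) = ⊥-elim (z≢t refl)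
  coatomOver-⋖ top    top    _   (_ , z≢t)   = ⊥-elim (z≢t refl)

  coatomOver-unique : (z w t : PE k l) → z ≢ bot → z ≤P w → w ⋖P t → w ≡ coatomOver z t
  coatomOver-unique z w t z≢⊥ z≤w w⋖t =
    [ (λ w≤c → sym (⋖P-maximal w t c w⋖t w≤c (proj₁ c⋖t)))
    , (λ c≤w → ⋖P-maximal c t w c⋖t c≤w (proj₁ w⋖t))
    ]′ (upset-total z w c z≢⊥ z≤w (coatomOver-≥ z t z≢⊥ z<t))
    where
    z<t : z <P t
    z<t = ≤P-<P-trans z w t z≤w (proj₁ w⋖t)
    c : PE k l
    c = coatomOver z t
    c⋖t : c ⋖P t
    c⋖t = coatomOver-⋖ z t z≢⊥ z<t

  -- The values a multichain with last entry b may take, read off from CoverCond.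
  Admissible : PE k l → PE k l → Set
  Admissible a b = a ≡ bot ⊎ a ≡ b ⊎ a ⋖P b

  admissible-≤ : (a b : PE k l) → Admissible a b → a ≤P b
  admissible-≤ a b (inj₁ refl)        = tt
  admissible-≤ a b (inj₂ (inj₁ refl)) = ≤P-refl a
  admissible-≤ a b (inj₂ (inj₂ a⋖b))  = ⋖P-≤ a⋖b

  admissible-below : (a b c : PE k l) → Admissible a b → a ≤P c → c ≤P b → Admissible a c
  admissible-below a b c (inj₁ a≡⊥)        _   _   = inj₁ a≡⊥
  admissible-below a b c (inj₂ (inj₁ refl)) a≤c c≤b = inj₂ (inj₁ (≤P-antisym a c a≤c c≤b))
  admissible-below a b c (inj₂ (inj₂ a⋖b))  a≤c c≤b with c ≟P b
  ... | yes refl = inj₂ (inj₂ a⋖b)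
  ... | no c≢b   = inj₂ (inj₁ (sym (⋖P-maximal a b c a⋖b a≤c (c≤b , c≢b))))

  admissible-≤-cover : (a b c : PE k l) → a ≢ bot → Admissible a b → a ⋖P c → b ≤P c
  admissible-≤-cover a b c a≢⊥ (inj₁ a≡⊥)        _   = ⊥-elim (a≢⊥ a≡⊥)
  admissible-≤-cover a b c _   (inj₂ (inj₁ refl)) a⋖c = ⋖P-≤ a⋖c
  admissible-≤-cover a b c a≢⊥ (inj₂ (inj₂ a⋖b))  a⋖c with upset-total a b c a≢⊥ (⋖P-≤ a⋖b) (⋖P-≤ a⋖c)
  ... | inj₁ b≤c = b≤c
  ... | inj₂ c≤b = ≤P-reflexive (sym (⋖P-upper-unique a c b a⋖c a⋖b c≤b))

  Within : PE k l → PE k l → PE k l → Set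
  Within p q a = a ≡ bot ⊎ a ≡ p ⊎ a ≡ q

  admissible-within : (p q a b : PE k l) → Admissible p q →
    Within p q a → Within p q b → a ≤P b → Admissible a b
  admissible-within p q a b pq (inj₁ a≡⊥) _ _ = inj₁ a≡⊥
  admissible-within p q a b pq _ (inj₁ refl) a≤b = inj₁ (≤P-bot a a≤b)
  admissible-within p q a b pq (inj₂ (inj₁ refl)) (inj₂ (inj₁ refl)) _ = inj₂ (inj₁ refl)
  admissible-within p q a b pq (inj₂ (inj₁ refl)) (inj₂ (inj₂ refl)) _ = pq
  admissible-within p q a b pq (inj₂ (inj₂ refl)) (inj₂ (inj₁ refl)) a≤b =
    inj₂ (inj₁ (≤P-antisym a b a≤b (admissible-≤ b a pq)))
  admissible-within p q a b pq (inj₂ (inj₂ refl)) (inj₂ (inj₂ refl)) _ = inj₂ (inj₁ refl)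

  admissible-∧-≤ : (a a' b b' : PE k l) → a ≤P a' →
    Admissible a b → Admissible a' b' → Admissible a (b ∧P b')
  admissible-∧-≤ a a' b b' a≤a' adm adm' with a ≟P bot
  ... | yes a≡⊥ = inj₁ a≡⊥
  ... | no a≢⊥  =
    [ (λ b≤b' → subst (Admissible a) (sym (∧P-≤-≡ b b' b≤b')) adm)
    , (λ b'≤b → subst (Admissible a) (sym (∧P-≥-≡ b b' b'≤b)) (admissible-below a b b' adm a≤b' b'≤b))
    ]′ (upset-total a b b' a≢⊥ (admissible-≤ a b adm) a≤b')
    where
    a≤b' : a ≤P b'
    a≤b' = ≤P-trans a a' b' a≤a' (admissible-≤ a' b' adm')

  admissible-∧ : (a a' b b' : PE k l) →
    Admissible a b → Admissible a' b' → Admissible (a ∧P a') (b ∧P b')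
  admissible-∧ a a' b b' adm adm' with ∧P-trichotomy a a'
  ... | inj₁ (a≤a' , e)        rewrite e = admissible-∧-≤ a a' b b' a≤a' adm adm'
  ... | inj₂ (inj₁ (a'≤a , e)) rewrite e | ∧P-comm b b' = admissible-∧-≤ a' a b' b a'≤a adm' adm
  ... | inj₂ (inj₂ e)          rewrite e = inj₁ refl

  -- raise z t is the least element above z that may sit below the last entry t.
  raise : PE k l → PE k l → PE k l
  raise z t with z ≟P bot | z ≟P t
  ... | yes _ | _     = bot
  ... | no _  | yes _ = t
  ... | no _  | no _  = coatomOver z t

  raise-admissible : (z t : PE k l) → z ≤P t → Admissible (raise z t) t
  raise-admissible z t z≤t with z ≟P bot | z ≟P t
  ... | yes _   | _      = inj₁ refl
  ... | no _    | yes _  = inj₂ (inj₁ refl)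
  ... | no z≢⊥  | no z≢t = inj₂ (inj₂ (coatomOver-⋖ z t z≢⊥ (z≤t , z≢t)))

  raise-≥ : (z t : PE k l) → z ≤P t → z ≤P raise z t
  raise-≥ z t z≤t with z ≟P bot | z ≟P t
  ... | yes refl | _      = tt
  ... | no _     | yes _  = z≤t
  ... | no z≢⊥   | no z≢t = coatomOver-≥ z t z≢⊥ (z≤t , z≢t)

  raise-least : (z t T w : PE k l) → z ≤P t → t ≤P T → z ≤P w → Admissible w T → raise z t ≤P w
  raise-least z t T w z≤t t≤T z≤w adm with z ≟P bot | z ≟P t
  ... | yes _  | _        = tt
  ... | no _   | yes refl = z≤w
  ... | no z≢⊥ | no z≢t   = coatom≤w adm
    where
    c : PE k l
    c = coatomOver z t
    c⋖t : c ⋖P t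
    c⋖t = coatomOver-⋖ z t z≢⊥ (z≤t , z≢t)
    coatom≤w : Admissible w T → c ≤P w
    coatom≤w (inj₁ w≡⊥)        = ⊥-elim (z≢⊥ (≤P-bot z (subst (z ≤P_) w≡⊥ z≤w)))
    coatom≤w (inj₂ (inj₁ refl)) = ≤P-trans c t w (⋖P-≤ c⋖t) t≤T
    coatom≤w (inj₂ (inj₂ w⋖T)) with upset-total z c w z≢⊥ (coatomOver-≥ z t z≢⊥ (z≤t , z≢t)) z≤w
    ... | inj₁ c≤w = c≤w
    ... | inj₂ w≤c = ≤P-reflexive (⋖P-maximal w T c w⋖T w≤c (<P-≤P-trans c t T (proj₁ c⋖t) t≤T))

  raise-fixed : (z t : PE k l) → Admissible z t → raise z t ≡ z
  raise-fixed z t adm with z ≟P bot | z ≟P t | adm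
  ... | yes z≡⊥ | _      | _ = sym z≡⊥
  ... | no _    | yes z≡t | _ = sym z≡t
  ... | no z≢⊥  | no _   | inj₁ z≡⊥ = ⊥-elim (z≢⊥ z≡⊥)
  ... | no _    | no z≢t | inj₂ (inj₁ z≡t) = ⊥-elim (z≢t z≡t)
  ... | no z≢⊥  | no _   | inj₂ (inj₂ z⋖t) = sym (coatomOver-unique z z t z≢⊥ (≤P-refl z) z⋖t)

  spine-admissible : (j j' : ℕ) → j ℕ.≤ j' → j' ℕ.≤ suc j → LongSpine k l →
    Admissible (spine j) (spine j')
  spine-admissible j j' j≤j' j'≤1+j long with ℕ.m≤n⇒m<n∨m≡n j≤j'
  ... | inj₂ refl = inj₂ (inj₁ refl)
  ... | inj₁ j<j' with ℕ.≤-antisym j<j' j'≤1+j | ℕ.≤-<-connex j k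
  ...   | refl | inj₁ j≤k = inj₂ (inj₂ (spine-⋖ long j j≤k))
  ...   | refl | inj₂ k<j = inj₂ (inj₁ (trans (spine-top j k<j) (sym (spine-top (suc j) (ℕ.m<n⇒m<1+n k<j)))))

  raise-≢top : (z t : PE k l) → z ≤P t → z ≢ top → raise z t ≢ top
  raise-≢top z t z≤t z≢⊤ with z ≟P bot | z ≟P t
  ... | yes _    | _        = λ ()
  ... | no _     | yes refl = z≢⊤
  ... | no z≢⊥   | no z≢t   = λ c≡⊤ → proj₂ c<t (trans c≡⊤ (sym (top-≤P t (subst (_≤P t) c≡⊤ (proj₁ c<t)))))
    where
    c<t : coatomOver z t <P t
    c<t = proj₁ (coatomOver-⋖ z t z≢⊥ (z≤t , z≢t))

  ∧P-bot⇒≰ : (u a : PE k l) → u ≢ bot → (u ∧P a) ≤P bot → ¬ u ≤P a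
  ∧P-bot⇒≰ u a u≢⊥ u∧a≤⊥ u≤a = u≢⊥ (≤P-bot u (subst (_≤P bot) (∧P-≤-≡ u a u≤a) u∧a≤⊥))

  ∧P-bot-upward : (u w a : PE k l) → u ≢ bot → u ≤P w → w ≢ top →
    (u ∧P a) ≤P bot → (w ∧P a) ≤P bot
  ∧P-bot-upward u w a u≢⊥ u≤w w≢⊤ u∧a≤⊥ with ∧P-trichotomy w a
  ... | inj₁ (w≤a , _) = ⊥-elim (∧P-bot⇒≰ u a u≢⊥ u∧a≤⊥ (≤P-trans u w a u≤w w≤a))
  ... | inj₂ (inj₂ w∧a≡⊥) rewrite w∧a≡⊥ = tt
  ... | inj₂ (inj₁ (a≤w , w∧a≡a)) rewrite w∧a≡a =
    [ ⊥-elim ∘ ∧P-bot⇒≰ u a u≢⊥ u∧a≤⊥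
    , (λ a≤u → subst (_≤P bot) (∧P-≥-≡ u a a≤u) u∧a≤⊥)
    ]′ (downset-total w u a w≢⊤ u≤w a≤w)

  raise-∧-bot : (u t a : PE k l) → u ≤P t → (u ∧P a) ≤P bot → (raise u t ∧P a) ≤P bot
  raise-∧-bot bot    t a _   _     = tt
  raise-∧-bot top    t a _   u∧a≤⊥ =
    ≤P-trans (raise top t ∧P a) a bot (∧P-lowerʳ (raise top t) a)
      (subst (_≤P bot) (∧P-≥-≡ top a (≤P-top a)) u∧a≤⊥)
  raise-∧-bot (ch i) t a u≤t u∧a≤⊥ =
    ∧P-bot-upward (ch i) (raise (ch i) t) a (λ ())
      (raise-≥ (ch i) t u≤t) (raise-≢top (ch i) t u≤t (λ ())) u∧a≤⊥
  raise-∧-bot (an s) t a u≤t u∧a≤⊥ =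
    ∧P-bot-upward (an s) (raise (an s) t) a (λ ())
      (raise-≥ (an s) t u≤t) (raise-≢top (an s) t u≤t (λ ())) u∧a≤⊥

  spine-≷-ch : (j : ℕ) (h : Fin k) → spine j ≤P ch {l = l} h ⊎ ch {l = l} h ≤P spine j
  spine-≷-ch j h =
    [ (λ j≤h → inj₁ (subst (spine j ≤P_) (spine-ch h) (spine-mono j (suc (toℕ h)) j≤h)))
    , (λ h≤j → inj₂ (subst (_≤P spine j) (spine-ch h) (spine-mono (suc (toℕ h)) j h≤j)))
    ]′ (ℕ.≤-total j (suc (toℕ h)))

  spine-≷-above : (j : ℕ) (a a' : PE k l) → a ≢ bot → a ≤P a' → ¬ a' ≤P a →
    spine j ≤P a' ⊎ a' ≤P spine j
  spine-≷-above j bot    _      a≢⊥ _    _    = ⊥-elim (a≢⊥ refl)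
  spine-≷-above j (ch i) (ch h) _   _    _    = spine-≷-ch j h
  spine-≷-above j (an s) (an _) _   refl a'≰a = ⊥-elim (a'≰a refl)
  spine-≷-above j a      top    _   _    _    = inj₁ (≤P-top (spine j))

  spine-≤-from-∧ : (j : ℕ) (a a' : PE k l) → a ≢ bot → a ≤P a' → ¬ a' ≤P a →
    (spine j ∧P a') ≤P a → spine j ≤P a
  spine-≤-from-∧ j a a' a≢⊥ a≤a' a'≰a u∧a'≤a with spine-≷-above j a a' a≢⊥ a≤a' a'≰a
  ... | inj₁ u≤a' = subst (_≤P a) (∧P-≤-≡ (spine j) a' u≤a') u∧a'≤a
  ... | inj₂ a'≤u = ⊥-elim (a'≰a (subst (_≤P a) (∧P-≥-≡ (spine j) a' a'≤u) u∧a'≤a))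

  raise-∨-fixed : (a t a' u : PE k l) → u ≤P a → Admissible a t → (raise (a ∨P u) t ∧P a') ≤P a
  raise-∨-fixed a t a' u u≤a adm rewrite ∨P-≥-≡ a u u≤a | raise-fixed a t adm = ∧P-lowerˡ a a'

  -- The hypothesis of leftModular-by-retraction at one entry of a chain element whose entry
  -- there is spine j and whose last entry is spine j'; b is the last entry of a.
  spine-modular : LongSpine k l → (a b a' : PE k l) (j j' : ℕ) → j ℕ.≤ j' → j' ℕ.≤ suc j →
    Admissible a b → a ≤P a' → (spine j ∧P a') ≤P a →
    (raise (a ∨P spine j) (b ∨P spine j') ∧P a') ≤P a
  spine-modular long a b a' j j' j≤j' j'≤1+j adm a≤a' u∧a'≤a with a' ≤P? a
  ... | yes a'≤a = ≤P-trans (w ∧P a') a' a (∧P-lowerʳ w a') a'≤a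
    where w = raise (a ∨P spine j) (b ∨P spine j')
  ... | no a'≰a = strict a adm a≤a' a'≰a u∧a'≤a
    where
    u v t : PE k l
    u = spine j
    v = spine j'
    t = b ∨P v
    u≤t : u ≤P t
    u≤t = ≤P-trans u v t (spine-mono j j' j≤j') (∨P-upperʳ b v)
    strict : (a : PE k l) → Admissible a b → a ≤P a' → ¬ a' ≤P a → (u ∧P a') ≤P a →
      (raise (a ∨P u) t ∧P a') ≤P a
    strict bot _ _ _ u∧a'≤⊥ = raise-∧-bot u t a' u≤t u∧a'≤⊥
    strict top _ _ a'≰a _ = ⊥-elim (a'≰a (≤P-top a'))
    strict (an s) adm a≤a' a'≰a u∧a'≤a =
      raise-∨-fixed (an s) t a' u (spine-≤-from-∧ j (an s) a' (λ ()) a≤a' a'≰a u∧a'≤a)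
        (admissible-below (an s) top t (inj₂ (inj₂ (an⋖top s))) a≤t (≤P-top t))
      where a≤t = ≤P-trans (an s) b t (admissible-≤ (an s) b adm) (∨P-upperˡ b v)
    strict (ch i) adm a≤a' a'≰a u∧a'≤a =
      raise-∨-fixed (ch i) t a' u u≤a (admissible-below (ch i) A' t (inj₂ (inj₂ a⋖A')) a≤t t≤A')
      where
      u≤a : u ≤P ch i
      u≤a = spine-≤-from-∧ j (ch i) a' (λ ()) a≤a' a'≰a u∧a'≤a
      A' : PE k l
      A' = spine (suc (suc (toℕ i)))
      a⋖A' : ch i ⋖P A'
      a⋖A' = subst (_⋖P A') (spine-ch i) (spine-⋖ long (suc (toℕ i)) (Fin.toℕ<n i))
      a≤t : ch i ≤P t
      a≤t = ≤P-trans (ch i) b t (admissible-≤ (ch i) b adm) (∨P-upperˡ b v)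
      j≤1+i : j ℕ.≤ suc (toℕ i)
      j≤1+i = spine-reflect j (suc (toℕ i)) (subst (u ≤P_) (sym (spine-ch i)) u≤a) (Fin.toℕ<n i)
      t≤A' : t ≤P A'
      t≤A' = ∨P-least A' b v (admissible-≤-cover (ch i) b A' (λ ()) adm a⋖A')
        (spine-mono j' _ (ℕ.≤-trans j'≤1+j (s≤s j≤1+i)))

-- The lattice P_{k,l}^⟨m⟩

module CoverLattice (k l m : ℕ) where

  Elt : Set
  Elt = CoverElt k l (suc m)

  last : Fin (suc m)
  last = fromℕ m

  Monotone : (Fin (suc m) → PE k l) → Set
  Monotone z = ∀ i j → i Fin.≤ j → z i ≤P z j

  AdmissibleTuple : (Fin (suc m) → PE k l) → Set
  AdmissibleTuple z = ∀ p → Admissible (z p) (z last)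

  admissible⇒coverCond : (z : Fin (suc m) → PE k l) → Monotone z → AdmissibleTuple z → CoverCond z
  admissible⇒coverCond z mono adm
    with Fin.any? (λ p → ¬? (z p ≟P bot) ×-dec ¬? (z p ≟P z last))
  ... | no none = inj₁ (z last , λ i → lastOrBot i)
    where
    lastOrBot : ∀ i → z i ≡ bot ⊎ z i ≡ z last
    lastOrBot i with z i ≟P bot | z i ≟P z last
    ... | yes z≡⊥ | _       = inj₁ z≡⊥
    ... | no _    | yes z≡t = inj₂ z≡t
    ... | no z≢⊥  | no z≢t  = ⊥-elim (none (i , z≢⊥ , z≢t))
  ... | yes (p₀ , z≢⊥ , z≢t) = inj₂ (z p₀ , z last , p₀⋖last , within)
    where
    p₀⋖last : z p₀ ⋖P z last
    p₀⋖last with adm p₀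
    ... | inj₁ z≡⊥          = ⊥-elim (z≢⊥ z≡⊥)
    ... | inj₂ (inj₁ z≡t)   = ⊥-elim (z≢t z≡t)
    ... | inj₂ (inj₂ z⋖t)   = z⋖t
    -- two coatoms of z last occurring in the multichain are comparable, hence equal
    within : ∀ i → Within (z p₀) (z last) (z i)
    within i with adm i
    ... | inj₁ z≡⊥        = inj₁ z≡⊥
    ... | inj₂ (inj₁ z≡t) = inj₂ (inj₂ z≡t)
    ... | inj₂ (inj₂ z⋖t) with Fin.≤-total i p₀
    ...   | inj₁ i≤p₀ =
      inj₂ (inj₁ (sym (⋖P-maximal (z i) (z last) (z p₀) z⋖t (mono i p₀ i≤p₀) (proj₁ p₀⋖last))))
    ...   | inj₂ p₀≤i =
      inj₂ (inj₁ (⋖P-maximal (z p₀) (z last) (z i) p₀⋖last (mono p₀ i p₀≤i) (proj₁ z⋖t)))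

  admissibleTuple : (e : Elt) → AdmissibleTuple (x e)
  admissibleTuple e p with cond e
  ... | inj₁ (p₀ , within) =
    admissible-within p₀ p₀ (x e p) (x e last) (inj₂ (inj₁ refl))
      (lift (within p)) (lift (within last)) (multi e p last (Fin.≤fromℕ p))
    where
    lift : ∀ {a} → a ≡ bot ⊎ a ≡ p₀ → Within p₀ p₀ a
    lift (inj₁ a≡⊥) = inj₁ a≡⊥
    lift (inj₂ a≡p) = inj₂ (inj₁ a≡p)
  ... | inj₂ (p₀ , q₀ , p₀⋖q₀ , within) =
    admissible-within p₀ q₀ (x e p) (x e last) (inj₂ (inj₂ p₀⋖q₀))
      (within p) (within last) (multi e p last (Fin.≤fromℕ p))

  mkElt : (z : Fin (suc m) → PE k l) → Monotone z → AdmissibleTuple z → Elt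
  mkElt z mono adm = mkCover z mono (admissible⇒coverCond z mono adm)

  _⊓_ : Elt → Elt → Elt
  e ⊓ f = mkElt z mono adm
    where
    z : Fin (suc m) → PE k l
    z p = x e p ∧P x f p
    mono : Monotone z
    mono i j i≤j = ∧P-greatest (z i) (x e j) (x f j)
      (≤P-trans (z i) (x e i) (x e j) (∧P-lowerˡ (x e i) (x f i)) (multi e i j i≤j))
      (≤P-trans (z i) (x f i) (x f j) (∧P-lowerʳ (x e i) (x f i)) (multi f i j i≤j))
    adm : AdmissibleTuple z
    adm p = admissible-∧ (x e p) (x f p) (x e last) (x f last) (admissibleTuple e p) (admissibleTuple f p)

  entryJoin : Elt → Elt → Fin (suc m) → PE k l
  entryJoin e f p = x e p ∨P x f p

  entryJoin-mono : (e f : Elt) → Monotone (entryJoin e f)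
  entryJoin-mono e f i j i≤j = ∨P-least (entryJoin e f j) (x e i) (x f i)
    (≤P-trans (x e i) (x e j) (entryJoin e f j) (multi e i j i≤j) (∨P-upperˡ (x e j) (x f j)))
    (≤P-trans (x f i) (x f j) (entryJoin e f j) (multi f i j i≤j) (∨P-upperʳ (x e j) (x f j)))

  entryJoin-≤last : (e f : Elt) (p : Fin (suc m)) → entryJoin e f p ≤P entryJoin e f last
  entryJoin-≤last e f p = entryJoin-mono e f p last (Fin.≤fromℕ p)

  _⊔_ : Elt → Elt → Elt
  e ⊔ f = mkElt w mono adm
    where
    t : PE k l
    t = entryJoin e f last
    w : Fin (suc m) → PE k l
    w p = raise (entryJoin e f p) t
    mono : Monotone w
    mono i j i≤j = raise-least (entryJoin e f i) t t (w j) (entryJoin-≤last e f i) (≤P-refl t)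
      (≤P-trans _ _ (w j) (entryJoin-mono e f i j i≤j) (raise-≥ (entryJoin e f j) t (entryJoin-≤last e f j)))
      (raise-admissible (entryJoin e f j) t (entryJoin-≤last e f j))
    adm : AdmissibleTuple w
    adm p rewrite raise-fixed t t (inj₂ (inj₁ refl)) = raise-admissible (entryJoin e f p) t (entryJoin-≤last e f p)

  entryJoin-≤-⊔ : (e f : Elt) (p : Fin (suc m)) → entryJoin e f p ≤P x (e ⊔ f) p
  entryJoin-≤-⊔ e f p = raise-≥ (entryJoin e f p) (entryJoin e f last) (entryJoin-≤last e f p)

  isPartialOrder : IsPartialOrder (_≈C_ {k} {l} {suc m}) _≤C_
  isPartialOrder = record
    { isPreorder = record
      { isEquivalence = record
        { refl  = λ _ → refl
        ; sym   = λ a≈b i → sym (a≈b i)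
        ; trans = λ a≈b b≈c i → trans (a≈b i) (b≈c i)
        }
      ; reflexive = λ a≈b i → ≤P-reflexive (a≈b i)
      ; trans     = λ {a} {b} {c} a≤b b≤c i → ≤P-trans (x a i) (x b i) (x c i) (a≤b i) (b≤c i)
      }
    ; antisym = λ {a} {b} a≤b b≤a i → ≤P-antisym (x a i) (x b i) (a≤b i) (b≤a i)
    }

  isLattice : IsLattice (_≈C_ {k} {l} {suc m}) _≤C_ _⊔_ _⊓_
  isLattice = record
    { isPartialOrder = isPartialOrder
    ; supremum = λ e f →
        (λ p → ≤P-trans (x e p) (entryJoin e f p) _ (∨P-upperˡ (x e p) (x f p)) (entryJoin-≤-⊔ e f p))
      , (λ p → ≤P-trans (x f p) (entryJoin e f p) _ (∨P-upperʳ (x e p) (x f p)) (entryJoin-≤-⊔ e f p))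
      , (λ u e≤u f≤u p → raise-least (entryJoin e f p) (entryJoin e f last) (x u last) (x u p) (entryJoin-≤last e f p)
            (∨P-least (x u last) (x e last) (x f last) (e≤u last) (f≤u last))
            (∨P-least (x u p) (x e p) (x f p) (e≤u p) (f≤u p)) (admissibleTuple u p))
    ; infimum = λ e f →
        (λ p → ∧P-lowerˡ (x e p) (x f p))
      , (λ p → ∧P-lowerʳ (x e p) (x f p))
      , (λ u u≤e u≤f p → ∧P-greatest (x u p) (x e p) (x f p) (u≤e p) (u≤f p))
    }

-- A maximal chain of left-modular elements

-- chainAt n has entry spine ⌊(n + p)/(m + 1)⌋ at position p, so passing from n to n + 1
-- raises exactly one entry by one step along the spine.
module SpineChain (k l m : ℕ) (long : LongSpine k l) where

  open CoverLattice k l m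

  level : ℕ → Fin (suc m) → ℕ
  level n p = (n + toℕ p) / suc m

  level-mono : (n : ℕ) {i j : Fin (suc m)} → i Fin.≤ j → level n i ℕ.≤ level n j
  level-mono n i≤j = /-monoˡ-≤ (suc m) (ℕ.+-monoʳ-≤ n i≤j)

  level-last : (n : ℕ) (p : Fin (suc m)) → level n last ℕ.≤ suc (level n p)
  level-last n p = ℕ.≤-trans (/-monoˡ-≤ (suc m) n+m≤n+p+M) (ℕ.≤-reflexive (+-/-step (n + toℕ p) (suc m)))
    where
    n+m≤n+p+M : n + toℕ last ℕ.≤ n + toℕ p + suc m
    n+m≤n+p+M rewrite Fin.toℕ-fromℕ m | ℕ.+-assoc n (toℕ p) (suc m) =
      ℕ.+-monoʳ-≤ n (ℕ.≤-trans (ℕ.n≤1+n m) (ℕ.m≤n+m (suc m) (toℕ p)))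

  chainAt : ℕ → Elt
  chainAt n = mkElt (spine ∘ level n) mono adm
    where
    mono : Monotone (spine ∘ level n)
    mono i j i≤j = spine-mono (level n i) (level n j) (level-mono n i≤j)
    adm : AdmissibleTuple (spine ∘ level n)
    adm p = spine-admissible (level n p) (level n last) (level-mono n (Fin.≤fromℕ p)) (level-last n p) long

  chainAt-leftModular : (n : ℕ) → IsLeftModularElt _≈C_ _≤C_ _⊔_ _⊓_ (chainAt n)
  chainAt-leftModular n = leftModular-by-retraction isLattice (chainAt n) λ a a' a≤a' c∧a'≤a p →
    spine-modular long (x a p) (x a last) (x a' p) (level n p) (level n last)
      (level-mono n (Fin.≤fromℕ p)) (level-last n p) (admissibleTuple a p) (a≤a' p) (c∧a'≤a p)

  ρ : Elt → ℕ
  ρ e = sum (rank ∘ x e)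

  ρ-cong : {a b : Elt} → a ≈C b → ρ a ≡ ρ b
  ρ-cong a≈b = sum-cong-≗ (cong rank ∘ a≈b)

  ρ-strict : {a b : Elt} → Strict _≈C_ _≤C_ a b → ρ a ℕ.< ρ b
  ρ-strict {a} {b} (a≤b , a≉b) with Fin.¬∀⟶∃¬ (suc m) (λ p → x a p ≡ x b p) (λ p → x a p ≟P x b p) a≉b
  ... | p₀ , a≢b = sum-mono-< (rank ∘ x a) (rank ∘ x b) (λ p → rank-mono (x a p) (x b p) (a≤b p)) p₀
                     (rank-strict long (a≤b p₀ , a≢b))

  N : ℕ
  N = suc k * suc m

  ρ-chainAt-suc : (n : ℕ) → n ℕ.< N → ρ (chainAt (suc n)) ≡ suc (ρ (chainAt n))
  ρ-chainAt-suc n n<N = ℕ.+-cancelˡ-≡ (h n) _ _ (begin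
    h n + ρ (chainAt (suc n))       ≡⟨ sum-window-shift h n (suc m) ⟩
    ρ (chainAt n) + h (n + suc m)   ≡⟨ cong (ρ (chainAt n) +_) h-step ⟩
    ρ (chainAt n) + suc (h n)       ≡⟨ ℕ.+-suc (ρ (chainAt n)) (h n) ⟩
    suc (ρ (chainAt n) + h n)       ≡⟨ cong suc (ℕ.+-comm (ρ (chainAt n)) (h n)) ⟩
    suc (h n + ρ (chainAt n))       ≡⟨ ℕ.+-suc (h n) (ρ (chainAt n)) ⟨
    h n + suc (ρ (chainAt n))       ∎)
    where
    open ≡-Reasoning
    h : ℕ → ℕ
    h i = rank (spine {k} {l} (i / suc m))
    n/M<1+k : n / suc m ℕ.< suc k
    n/M<1+k = m<n*o⇒m/o<n n<N
    h-step : h (n + suc m) ≡ suc (h n)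
    h-step = begin
      h (n + suc m)                         ≡⟨ cong (rank ∘ spine) (+-/-step n (suc m)) ⟩
      rank (spine {k} {l} (suc (n / suc m))) ≡⟨ rank-spine (suc (n / suc m)) n/M<1+k ⟩
      suc (n / suc m)                       ≡⟨ cong suc (rank-spine (n / suc m) (ℕ.<⇒≤ n/M<1+k)) ⟨
      suc (h n)                             ∎

  chainAt-⋖ : (n : ℕ) → n ℕ.< N → Covers _≈C_ _≤C_ (chainAt n) (chainAt (suc n))
  chainAt-⋖ n n<N =
    covers-by-rank (_≈C_ {k} {l} {suc m}) _≤C_ ρ (λ {a} {b} → ρ-cong {a} {b}) (λ {a} {b} → ρ-strict {a} {b})
      {chainAt n} {chainAt (suc n)}
    (λ p → spine-mono _ _ (/-monoˡ-≤ (suc m) (ℕ.n≤1+n (n + toℕ p))))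
    (ρ-chainAt-suc n n<N)

  chainAt-least : IsLeast _≈C_ _≤C_ (chainAt 0)
  chainAt-least b p = subst (λ j → spine j ≤P x b p) (sym (m<n⇒m/n≡0 (Fin.toℕ<n p))) tt

  chainAt-greatest : IsGreatest _≈C_ _≤C_ (chainAt N)
  chainAt-greatest b p = subst (x b p ≤P_) (sym (spine-top _ k<level)) (≤P-top (x b p))
    where
    k<level : k ℕ.< level N p
    k<level = subst (ℕ._≤ level N p) (m*n/n≡m (suc k) (suc m)) (/-monoˡ-≤ (suc m) (ℕ.m≤m+n N (toℕ p)))

  hasLeftModularChain : HasLeftModularChain _≈C_ _≤C_ _⊔_ _⊓_
  hasLeftModularChain =
    N , chain ,
    chainAt-least ,
    subst (IsGreatest _≈C_ _≤C_)
      (sym (trans (chain-lookup (fromℕ N)) (cong chainAt (Fin.toℕ-fromℕ N)))) chainAt-greatest ,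
    (λ i → subst₂ (Covers _≈C_ _≤C_)
             (sym (trans (chain-lookup (inject₁ i)) (cong chainAt (Fin.toℕ-inject₁ i))))
             (sym (chain-lookup (Fin.suc i)))
             (chainAt-⋖ (toℕ i) (Fin.toℕ<n i))) ,
    (λ i → subst (IsLeftModularElt _≈C_ _≤C_ _⊔_ _⊓_) (sym (chain-lookup i)) (chainAt-leftModular (toℕ i)))
    where
    chain : Vec Elt (suc N)
    chain = tabulate (chainAt ∘ toℕ)
    chain-lookup : (i : Fin (suc N)) → lookup chain i ≡ chainAt (toℕ i)
    chain-lookup = lookup∘tabulate (chainAt ∘ toℕ)

  isLeftModularLattice : IsLeftModularLattice (_≈C_ {k} {l} {suc m}) _≤C_
  isLeftModularLattice = _⊔_ , _⊓_ , isLattice , hasLeftModularChain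

-- The case k = 0 < l, via P_{0,l+1} ≅ P_{1,l}

module _ {k l k' l' : ℕ} (f : PE k l → PE k' l') (g : PE k' l' → PE k l)
  (f-mono : ∀ p q → p ≤P q → f p ≤P f q) (g-mono : ∀ p q → p ≤P q → g p ≤P g q)
  (gf : ∀ p → g (f p) ≡ p) (fg : ∀ p → f (g p) ≡ p) where

  iso-bot : f bot ≡ bot
  iso-bot = ≤P-bot (f bot) (subst (f bot ≤P_) (fg bot) (f-mono bot (g bot) tt))

  iso-⋖ : ∀ {p q} → p ⋖P q → f p ⋖P f q
  iso-⋖ {p} {q} ((p≤q , p≢q) , between) =
    (f-mono p q p≤q , λ fp≡fq → p≢q (trans (sym (gf p)) (trans (cong g fp≡fq) (gf q)))) ,
    λ r (fp≤r , fp≢r) (r≤fq , r≢fq) → between (g r)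
      (subst (_≤P g r) (gf p) (g-mono (f p) r fp≤r) , λ p≡gr → fp≢r (trans (cong f p≡gr) (fg r)))
      (subst (g r ≤P_) (gf q) (g-mono r (f q) r≤fq) , λ gr≡q → r≢fq (trans (sym (fg r)) (cong f gr≡q)))

  iso-admissible : ∀ {a b} → Admissible a b → Admissible (f a) (f b)
  iso-admissible (inj₁ refl)        = inj₁ iso-bot
  iso-admissible (inj₂ (inj₁ refl)) = inj₂ (inj₁ refl)
  iso-admissible (inj₂ (inj₂ a⋖b))  = inj₂ (inj₂ (iso-⋖ a⋖b))

  mapCover : (m : ℕ) → CoverElt k l (suc m) → CoverElt k' l' (suc m)
  mapCover m e = CoverLattice.mkElt k' l' m (f ∘ x e)
    (λ i j i≤j → f-mono _ _ (multi e i j i≤j))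
    (iso-admissible ∘ CoverLattice.admissibleTuple k l m e)

module AtomAsChain (l : ℕ) where

  φ : PE 0 (suc l) → PE 1 l
  φ bot              = bot
  φ (an Fin.zero)    = ch Fin.zero
  φ (an (Fin.suc s)) = an s
  φ top              = top

  ψ : PE 1 l → PE 0 (suc l)
  ψ bot            = bot
  ψ (ch Fin.zero)  = an Fin.zero
  ψ (an s)         = an (Fin.suc s)
  ψ top            = top

  ψφ : ∀ p → ψ (φ p) ≡ p
  ψφ bot              = refl
  ψφ (an Fin.zero)    = refl
  ψφ (an (Fin.suc s)) = refl
  ψφ top              = refl

  φψ : ∀ p → φ (ψ p) ≡ p
  φψ bot           = refl
  φψ (ch Fin.zero) = refl
  φψ (an s)        = refl
  φψ top           = refl

  φ-mono : ∀ p q → p ≤P q → φ p ≤P φ q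
  φ-mono bot    q      _    = tt
  φ-mono (an s) (an s) refl = ≤P-refl (φ (an s))
  φ-mono (an s) top    _    = ≤P-top (φ (an s))
  φ-mono top    top    _    = tt

  ψ-mono : ∀ p q → p ≤P q → ψ p ≤P ψ q
  ψ-mono bot           q             _    = tt
  ψ-mono (ch Fin.zero) (ch Fin.zero) _    = refl
  ψ-mono (ch Fin.zero) top           _    = tt
  ψ-mono (an s)        (an s)        refl = refl
  ψ-mono (an s)        top           _    = tt
  ψ-mono top           top           _    = tt

lemma2p18 : (k l m : ℕ) → 0 < m →
    IsLeftModularLattice (_≈C_ {k} {l} {m}) (_≤C_ {k} {l} {m})
lemma2p18 k       l       zero    ()
lemma2p18 (suc k) l       (suc m) _ = SpineChain.isLeftModularLattice (suc k) l m (inj₁ (s≤s z≤n))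
lemma2p18 zero    zero    (suc m) _ = SpineChain.isLeftModularLattice 0 0 m (inj₂ refl)
lemma2p18 zero    (suc l) (suc m) _ =
  _⊔_ , _⊓_ , isLattice ,
  OrderIsoTransport.Ψ-chain isLattice (CoverLattice.isLattice 1 l m)
    (mapCover φ ψ φ-mono ψ-mono ψφ φψ m) (mapCover ψ φ ψ-mono φ-mono φψ ψφ m)
    (λ a≤a' i → φ-mono _ _ (a≤a' i)) (λ b≤b' i → ψ-mono _ _ (b≤b' i))
    (λ a i → ψφ (x a i)) (λ b i → φψ (x b i))
    (SpineChain.hasLeftModularChain 1 l m (inj₁ (s≤s z≤n)))
  where
  open CoverLattice 0 (suc l) m
  open AtomAsChain l
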